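{- Let $D$ be an arbitrary subset of $\mathbb{Z}^n$ and assume that $D$ admits a least majorized element. For any $x\in D$ the following are equivalent: (A) $x$ is least majorized in $D$; (B) $x$ is decreasingly minimal in $D$; (C) $x$ is increasingly maximal in $D$.
   Context: $x{\downarrow}$ (resp. $x{\uparrow}$) is the vector of components of $x$ sorted in decreasing (resp. increasing) order; $\overline{x}(k)=\sum_{i=1}^k x{\downarrow}(i)$. $x\prec y$ means $\overline{x}(k)\le\overline{y}(k)$ for all $k$ and $\overline{x}(n)=\overline{y}(n)$; $x\in D$ is least majorized in $D$ if $x\prec y$ for all $y\in D$. $x\in D$ is decreasingly minimal in $D$ if for every $y\in D$, either $x{\downarrow}=y{\downarrow}$ or $x{\downarrow}(j)<y{\downarrow}(j)$ at the smallest index $j$ of difference. $x\in D$ is increasingly maximal in $D$ if for every $y\in D$, either $x{\uparrow}=y{\uparrow}$ or $x{\uparrow}(j)>y{\uparrow}(j)$ at the smallest index $j$ of difference. -}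

module Defs where

open import Data.Nat using (ℕ; _≤_)
open import Data.Integer using (ℤ; _<_; _>_; _+_; 0ℤ) renaming (_≤_ to _≤ℤ_)
open import Data.Integer.Properties using (≤-decTotalOrder)
open import Data.List using (List; []; _∷_; reverse; take; foldr)
open import Data.Empty using (⊥)
open import Data.List.Sort ≤-decTotalOrder using (sort)
open import Data.Vec using (Vec; toList)
open import Data.Product using (_×_)
open import Data.Sum using (_⊎_)
open import Relation.Binary.PropositionalEquality using (_≡_)

_↑ : ∀ {n} → Vec ℤ n → List ℤ
x ↑ = sort (toList x)

_↓ : ∀ {n} → Vec ℤ n → List ℤ
x ↓ = reverse (x ↑)

partial : ∀ {n} → Vec ℤ n → ℕ → ℤ
partial x k = foldr _+_ 0ℤ (take k (x ↓))

_≺_ : ∀ {n} → Vec ℤ n → Vec ℤ n → Set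
_≺_ {n} x y = (∀ k → k ≤ n → partial x k ≤ℤ partial y k) × (partial x n ≡ partial y n)

LexLt : List ℤ → List ℤ → Set
LexLt []       _        = ⊥
LexLt (_ ∷ _)  []       = ⊥
LexLt (a ∷ as) (b ∷ bs) = (a < b) ⊎ ((a ≡ b) × LexLt as bs)

LexGt : List ℤ → List ℤ → Set
LexGt []       _        = ⊥
LexGt (_ ∷ _)  []       = ⊥
LexGt (a ∷ as) (b ∷ bs) = (a > b) ⊎ ((a ≡ b) × LexGt as bs)

Subset : ℕ → Set₁
Subset n = Vec ℤ n → Set

LeastMajorized : ∀ {n} → Subset n → Vec ℤ n → Set
LeastMajorized {n} D x = D x × (∀ (y : Vec ℤ n) → D y → x ≺ y)

DecMinimal : ∀ {n} → Subset n → Vec ℤ n → Set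
DecMinimal {n} D x = D x × (∀ (y : Vec ℤ n) → D y → (x ↓ ≡ y ↓) ⊎ LexLt (x ↓) (y ↓))

IncMaximal : ∀ {n} → Subset n → Vec ℤ n → Set
IncMaximal {n} D x = D x × (∀ (y : Vec ℤ n) → D y → (x ↑ ≡ y ↑) ⊎ LexGt (x ↑) (y ↑))

module Submission where

-- (A ⇒ B)  If x ≺ y then the prefix sums of x↓ are bounded by those of y↓,
--          and a list whose prefix sums are bounded by those of another list
--          of the same length is lexicographically below it or equal to it.
-- (A ⇒ C)  The sum of the k smallest entries plus the sum of the n ∸ k
--          largest entries is the total sum, so x ≺ y reverses the
--          inequalities on the prefix sums of the increasing rearrangements;
--          the lexicographic argument then gives x↑ ≥ y↑.
-- (B, C ⇒ A)  Let z be a least majorized element.  By (A ⇒ B) resp.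
--          (A ⇒ C) the element z is itself decreasingly minimal resp.
--          increasingly maximal; since the strict lexicographic order is
--          asymmetric, comparing x and z both ways forces x↓ ≡ z↓ (resp.
--          x↑ ≡ z↑), and majorization only depends on x↓.

open import Defs
open import Data.Nat using (ℕ)
open import Data.Integer using (ℤ)
open import Data.Vec using (Vec)
open import Data.Product using (Σ; _×_)
open import Function.Bundles using (_⇔_)

open import Data.Nat as ℕ using (suc; _∸_; s≤s; z≤n)
import Data.Nat.Properties as ℕP
open import Data.Integer using (_+_; -_; 0ℤ) renaming (_≤_ to _≤ℤ_)
import Data.Integer.Properties as ℤP
open import Data.List using (List; []; _∷_; [_]; reverse; take; drop; foldr; length; _++_)
import Data.List.Properties as LP
open import Data.List.Sort ℤP.≤-decTotalOrder using (sort-↭)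
open import Data.List.Relation.Binary.Permutation.Propositional.Properties using (↭-length)
open import Data.Vec using (toList)
open import Data.Vec.Properties using (length-toList)
open import Data.Product using (_,_; proj₁; proj₂)
open import Data.Sum using (_⊎_; inj₁; inj₂)
open import Data.Empty using (⊥; ⊥-elim)
open import Relation.Binary.PropositionalEquality using (_≡_; refl; sym; trans; cong; cong₂; subst; subst₂; module ≡-Reasoning)
open import Relation.Nullary using (yes; no)
open import Function.Bundles using (mk⇔)

sumℤ : List ℤ → ℤ
sumℤ = foldr _+_ 0ℤ

sumℤ-++ : ∀ xs ys → sumℤ (xs ++ ys) ≡ sumℤ xs + sumℤ ys
sumℤ-++ []       ys = sym (ℤP.+-identityˡ (sumℤ ys))
sumℤ-++ (x ∷ xs) ys = trans (cong (x +_) (sumℤ-++ xs ys)) (sym (ℤP.+-assoc x (sumℤ xs) (sumℤ ys)))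

sumℤ-reverse : ∀ xs → sumℤ (reverse xs) ≡ sumℤ xs
sumℤ-reverse []       = refl
sumℤ-reverse (x ∷ xs) = begin
  sumℤ (reverse (x ∷ xs))      ≡⟨ cong sumℤ (LP.unfold-reverse x xs) ⟩
  sumℤ (reverse xs ++ [ x ])   ≡⟨ sumℤ-++ (reverse xs) [ x ] ⟩
  sumℤ (reverse xs) + (x + 0ℤ) ≡⟨ cong₂ _+_ (sumℤ-reverse xs) (ℤP.+-identityʳ x) ⟩
  sumℤ xs + x                  ≡⟨ ℤP.+-comm (sumℤ xs) x ⟩
  x + sumℤ xs                  ∎
  where open ≡-Reasoning

take-length-++ : ∀ {A : Set} (xs ys : List A) → take (length xs) (xs ++ ys) ≡ xs
take-length-++ []       ys = refl
take-length-++ (x ∷ xs) ys = cong (x ∷_) (take-length-++ xs ys)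

take-reverse : ∀ {A : Set} k (xs : List A) → take (length xs ∸ k) (reverse xs) ≡ reverse (drop k xs)
take-reverse k xs = begin
  take (length xs ∸ k) (reverse xs)
    ≡⟨ cong₂ take length-suffix (cong reverse (sym (LP.take++drop≡id k xs))) ⟩
  take (length (reverse (drop k xs))) (reverse (take k xs ++ drop k xs))
    ≡⟨ cong (take _) (LP.reverse-++ (take k xs) (drop k xs)) ⟩
  take (length (reverse (drop k xs))) (reverse (drop k xs) ++ reverse (take k xs))
    ≡⟨ take-length-++ (reverse (drop k xs)) (reverse (take k xs)) ⟩
  reverse (drop k xs) ∎
  where
  open ≡-Reasoning
  length-suffix : length xs ∸ k ≡ length (reverse (drop k xs))
  length-suffix = trans (sym (LP.length-drop k xs)) (sym (LP.length-reverse (drop k xs)))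

sumℤ-take+sumℤ-take-reverse : ∀ k xs →
  sumℤ (take k xs) + sumℤ (take (length xs ∸ k) (reverse xs)) ≡ sumℤ xs
sumℤ-take+sumℤ-take-reverse k xs = begin
  sumℤ (take k xs) + sumℤ (take (length xs ∸ k) (reverse xs))
    ≡⟨ cong (λ ys → sumℤ (take k xs) + sumℤ ys) (take-reverse k xs) ⟩
  sumℤ (take k xs) + sumℤ (reverse (drop k xs))
    ≡⟨ cong (sumℤ (take k xs) +_) (sumℤ-reverse (drop k xs)) ⟩
  sumℤ (take k xs) + sumℤ (drop k xs)
    ≡⟨ sym (sumℤ-++ (take k xs) (drop k xs)) ⟩
  sumℤ (take k xs ++ drop k xs)
    ≡⟨ cong sumℤ (LP.take++drop≡id k xs) ⟩
  sumℤ xs ∎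
  where open ≡-Reasoning

+-cancelˡ-≤ : ∀ a {b c} → a + b ≤ℤ a + c → b ≤ℤ c
+-cancelˡ-≤ a {b} {c} a+b≤a+c =
  subst₂ _≤ℤ_ (neg-a+[a+i]≡i b) (neg-a+[a+i]≡i c) (ℤP.+-monoʳ-≤ (- a) a+b≤a+c)
  where
  neg-a+[a+i]≡i : ∀ i → - a + (a + i) ≡ i
  neg-a+[a+i]≡i i = trans (sym (ℤP.+-assoc (- a) a i))
                      (trans (cong (_+ i) (ℤP.+-inverseˡ a)) (ℤP.+-identityˡ i))

+-cancelʳ-≤ : ∀ {a b} c → a + c ≤ℤ b + c → a ≤ℤ b
+-cancelʳ-≤ {a} {b} c a+c≤b+c = +-cancelˡ-≤ c (subst₂ _≤ℤ_ (ℤP.+-comm a c) (ℤP.+-comm b c) a+c≤b+c)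

_≤Lex_ : List ℤ → List ℤ → Set
as ≤Lex bs = as ≡ bs ⊎ LexLt as bs

-- Lists of equal length whose prefix sums are bounded by those of the other
-- list are lexicographically smaller or equal: at the first differing entry
-- the bound on the prefix sum ending there is a bound on that entry.
prefixSums≤⇒≤Lex : (as bs : List ℤ) → length as ≡ length bs →
  (∀ k → k ℕ.≤ length as → sumℤ (take k as) ≤ℤ sumℤ (take k bs)) → as ≤Lex bs
prefixSums≤⇒≤Lex []       []       _ _ = inj₁ refl
prefixSums≤⇒≤Lex (a ∷ as) (b ∷ bs) equal-length prefix≤ with a ℤP.≟ b
... | no a≢b = inj₂ (inj₁ (ℤP.≤∧≢⇒< head≤ a≢b))
  where
  head≤ : a ≤ℤ b
  head≤ = subst₂ _≤ℤ_ (ℤP.+-identityʳ a) (ℤP.+-identityʳ b) (prefix≤ 1 (s≤s z≤n))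
... | yes refl with prefixSums≤⇒≤Lex as bs (ℕP.suc-injective equal-length)
                      (λ k k≤ → +-cancelˡ-≤ a (prefix≤ (suc k) (s≤s k≤)))
...   | inj₁ as≡bs = inj₁ (cong (a ∷_) as≡bs)
...   | inj₂ as<bs = inj₂ (inj₂ (refl , as<bs))

LexGt⇒flippedLexLt : ∀ as bs → LexGt as bs → LexLt bs as
LexGt⇒flippedLexLt (a ∷ as) (b ∷ bs) (inj₁ a>b)           = inj₁ a>b
LexGt⇒flippedLexLt (a ∷ as) (b ∷ bs) (inj₂ (a≡b , as>bs)) = inj₂ (sym a≡b , LexGt⇒flippedLexLt as bs as>bs)

flippedLexLt⇒LexGt : ∀ as bs → LexLt bs as → LexGt as bs
flippedLexLt⇒LexGt (a ∷ as) (b ∷ bs) (inj₁ b<a)           = inj₁ b<a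
flippedLexLt⇒LexGt (a ∷ as) (b ∷ bs) (inj₂ (b≡a , bs<as)) = inj₂ (sym b≡a , flippedLexLt⇒LexGt as bs bs<as)

≥Lex⇒flipped≤Lex : ∀ {as bs} → as ≡ bs ⊎ LexGt as bs → bs ≤Lex as
≥Lex⇒flipped≤Lex (inj₁ as≡bs) = inj₁ (sym as≡bs)
≥Lex⇒flipped≤Lex {as} {bs} (inj₂ as>bs) = inj₂ (LexGt⇒flippedLexLt as bs as>bs)

flipped≤Lex⇒≥Lex : ∀ {as bs} → bs ≤Lex as → as ≡ bs ⊎ LexGt as bs
flipped≤Lex⇒≥Lex (inj₁ bs≡as) = inj₁ (sym bs≡as)
flipped≤Lex⇒≥Lex {as} {bs} (inj₂ bs<as) = inj₂ (flippedLexLt⇒LexGt as bs bs<as)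

LexLt-irrefl : ∀ as → LexLt as as → ⊥
LexLt-irrefl (a ∷ as) (inj₁ a<a)       = ℤP.<-irrefl refl a<a
LexLt-irrefl (a ∷ as) (inj₂ (_ , as<as)) = LexLt-irrefl as as<as

LexLt-asym : ∀ as bs → LexLt as bs → LexLt bs as → ⊥
LexLt-asym (a ∷ as) (b ∷ bs) (inj₁ a<b)          (inj₁ b<a)          = ℤP.<-asym a<b b<a
LexLt-asym (a ∷ as) (b ∷ bs) (inj₁ a<b)          (inj₂ (b≡a , _))    = ℤP.<-irrefl (sym b≡a) a<b
LexLt-asym (a ∷ as) (b ∷ bs) (inj₂ (a≡b , _))    (inj₁ b<a)          = ℤP.<-irrefl (sym a≡b) b<a
LexLt-asym (a ∷ as) (b ∷ bs) (inj₂ (_ , as<bs))  (inj₂ (_ , bs<as))  = LexLt-asym as bs as<bs bs<as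

≤Lex-antisym : ∀ as bs → as ≤Lex bs → bs ≤Lex as → as ≡ bs
≤Lex-antisym as bs (inj₁ as≡bs) _              = as≡bs
≤Lex-antisym as bs (inj₂ as<bs) (inj₁ bs≡as)   = ⊥-elim (LexLt-irrefl as (subst (LexLt as) bs≡as as<bs))
≤Lex-antisym as bs (inj₂ as<bs) (inj₂ bs<as)   = ⊥-elim (LexLt-asym as bs as<bs bs<as)

length-↑ : ∀ {n} (x : Vec ℤ n) → length (x ↑) ≡ n
length-↑ x = trans (↭-length (sort-↭ (toList x))) (length-toList x)

length-↓ : ∀ {n} (x : Vec ℤ n) → length (x ↓) ≡ n
length-↓ x = trans (LP.length-reverse (x ↑)) (length-↑ x)

sum↑+partial≡total : ∀ {n} (x : Vec ℤ n) k → sumℤ (take k (x ↑)) + partial x (n ∸ k) ≡ partial x n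
sum↑+partial≡total {n} x k = begin
  sumℤ (take k (x ↑)) + sumℤ (take (n ∸ k) (x ↓))
    ≡⟨ cong (λ m → sumℤ (take k (x ↑)) + sumℤ (take (m ∸ k) (x ↓))) (sym (length-↑ x)) ⟩
  sumℤ (take k (x ↑)) + sumℤ (take (length (x ↑) ∸ k) (x ↓))
    ≡⟨ sumℤ-take+sumℤ-take-reverse k (x ↑) ⟩
  sumℤ (x ↑)
    ≡⟨ sym (sumℤ-reverse (x ↑)) ⟩
  sumℤ (x ↓)
    ≡⟨ cong sumℤ (sym (LP.take-all n (x ↓) (ℕP.≤-reflexive (length-↓ x)))) ⟩
  sumℤ (take n (x ↓)) ∎
  where open ≡-Reasoning

≺⇒sum↑-reversed : ∀ {n} (x y : Vec ℤ n) → x ≺ y → ∀ k → sumℤ (take k (y ↑)) ≤ℤ sumℤ (take k (x ↑))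
≺⇒sum↑-reversed {n} x y (partial≤ , total≡) k = +-cancelʳ-≤ (partial y (n ∸ k)) (begin
  sumℤ (take k (y ↑)) + partial y (n ∸ k) ≡⟨ sum↑+partial≡total y k ⟩
  partial y n                             ≡⟨ sym total≡ ⟩
  partial x n                             ≡⟨ sym (sum↑+partial≡total x k) ⟩
  sumℤ (take k (x ↑)) + partial x (n ∸ k) ≤⟨ ℤP.+-monoʳ-≤ (sumℤ (take k (x ↑))) (partial≤ (n ∸ k) (ℕP.m∸n≤m n k)) ⟩
  sumℤ (take k (x ↑)) + partial y (n ∸ k) ∎)
  where open ℤP.≤-Reasoning

module _ {n : ℕ} (D : Subset n) where

  LeastMajorized-↓ : ∀ {x z} → D x → x ↓ ≡ z ↓ → LeastMajorized D z → LeastMajorized D x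
  LeastMajorized-↓ {x} {z} Dx x↓≡z↓ (_ , z≺) = Dx , λ y Dy →
    (λ k k≤n → subst (_≤ℤ partial y k) (same-partial k) (proj₁ (z≺ y Dy) k k≤n)) ,
    trans (sym (same-partial n)) (proj₂ (z≺ y Dy))
    where
    same-partial : ∀ k → partial z k ≡ partial x k
    same-partial k = cong (λ xs → sumℤ (take k xs)) (sym x↓≡z↓)

  -- (A ⇒ B): the defining inequalities of x ≺ y are prefix-sum bounds on x↓.
  LeastMajorized⇒DecMinimal : ∀ x → LeastMajorized D x → DecMinimal D x
  LeastMajorized⇒DecMinimal x (Dx , x≺) = Dx , λ y Dy →
    prefixSums≤⇒≤Lex (x ↓) (y ↓) (trans (length-↓ x) (sym (length-↓ y)))
      (λ k k≤ → proj₁ (x≺ y Dy) k (subst (k ℕ.≤_) (length-↓ x) k≤))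

  -- (A ⇒ C): by ≺⇒sum↑-reversed, y↑ has prefix sums bounded by those of x↑.
  LeastMajorized⇒IncMaximal : ∀ x → LeastMajorized D x → IncMaximal D x
  LeastMajorized⇒IncMaximal x (Dx , x≺) = Dx , λ y Dy →
    flipped≤Lex⇒≥Lex (prefixSums≤⇒≤Lex (y ↑) (x ↑) (trans (length-↑ y) (sym (length-↑ x)))
      (λ k _ → ≺⇒sum↑-reversed x y (x≺ y Dy) k))

  -- (B ⇒ A): x and the least majorized z are each ≤Lex the other on ↓.
  DecMinimal⇒LeastMajorized : Σ (Vec ℤ n) (LeastMajorized D) → ∀ x → DecMinimal D x → LeastMajorized D x
  DecMinimal⇒LeastMajorized (z , z-least) x (Dx , x-min) = LeastMajorized-↓ Dx x↓≡z↓ z-least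
    where
    x↓≡z↓ : x ↓ ≡ z ↓
    x↓≡z↓ = ≤Lex-antisym (x ↓) (z ↓) (x-min z (proj₁ z-least))
              (proj₂ (LeastMajorized⇒DecMinimal z z-least) x Dx)

  -- (C ⇒ A): the same comparison on ↑, and x↓ is the reversal of x↑.
  IncMaximal⇒LeastMajorized : Σ (Vec ℤ n) (LeastMajorized D) → ∀ x → IncMaximal D x → LeastMajorized D x
  IncMaximal⇒LeastMajorized (z , z-least) x (Dx , x-max) = LeastMajorized-↓ Dx (cong reverse x↑≡z↑) z-least
    where
    x↑≡z↑ : x ↑ ≡ z ↑
    x↑≡z↑ = ≤Lex-antisym (x ↑) (z ↑)
              (≥Lex⇒flipped≤Lex (proj₂ (LeastMajorized⇒IncMaximal z z-least) x Dx))
              (≥Lex⇒flipped≤Lex (x-max z (proj₁ z-least)))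

proposition2p7 : (n : ℕ) (D : Subset n) → Σ (Vec ℤ n) (LeastMajorized D) → (x : Vec ℤ n) → D x → (LeastMajorized D x ⇔ DecMinimal D x) × (DecMinimal D x ⇔ IncMaximal D x)
proposition2p7 n D least x _ =
  mk⇔ (LeastMajorized⇒DecMinimal D x) (DecMinimal⇒LeastMajorized D least x) ,
  mk⇔ (λ dec-min → LeastMajorized⇒IncMaximal D x (DecMinimal⇒LeastMajorized D least x dec-min))
      (λ inc-max → LeastMajorized⇒DecMinimal D x (IncMaximal⇒LeastMajorized D least x inc-max))
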